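{- Let $F(X,Y)$ be a CNF formula and $C$ a clause of $F$. Let $(\vec{r},U^*,C)$ and $(\vec{s},U^{**},C)$ be D-sequents that hold for $\exists X[F]$, that can be resolved on a variable $v$, and that both have the scale-down property. Then the D-sequent $(\vec{q},U^*\cup U^{**},C)$ obtained by resolving them on $v$ also has the scale-down property.
   Context: Formulas are CNF over Boolean variables, viewed as sets of clauses; $X,Y$ are disjoint variable sets. An assignment is a map from a set of variables to $\{0,1\}$; $\vec{q}\subseteq\vec{q}\,'$ means $\vec{q}\,'$ assigns all variables of $\vec{q}$ with the same values. $C_{\vec{q}}=1$ if $\vec{q}$ satisfies $C$, else $C$ minus falsified literals; $F_{\vec{q}}$ removes satisfied clauses and replaces others by their restriction. $C$ is redundant in $\exists X[F]$ if $\exists X[F]\equiv\exists X[F\setminus\{C\}]$ (equivalence as functions of free variables). A D-sequent $(\vec{q},U,C)$ holds for $\exists X[F]$ if $C_{\vec{q}}$ is redundant in $\exists X[F_{\vec{q}}]$; it has the scale-down property if $(\vec{q}\,',U,C)$ holds for every $\vec{q}\,'\supseteq\vec{q}$. Resolution: if the conditionals $\vec{r},\vec{s}$ have exactly one common variable $v$ assigned different values in them, the resolvent on $v$ is $(\vec{q},U^*\cup U^{**},C)$ with $\vec{q}$ equal to $\vec{r}\cup\vec{s}$ minus the assignments to $v$. -}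

module Defs where

open import Data.Nat using (ℕ; _≡ᵇ_)
open import Data.Bool using (Bool; true; false; not; _∧_; _∨_; if_then_else_)
open import Data.Maybe using (Maybe; just; nothing)
open import Data.Product using (Σ; _×_; _,_)
open import Data.List using (List; []; _∷_; _++_)
open import Data.List.Relation.Unary.All using (All)
open import Data.List.Relation.Unary.Any using (Any)
open import Relation.Binary.PropositionalEquality using (_≡_)
open import Relation.Nullary using (¬_; does)
open import Relation.Unary using (Pred)
open import Level using (0ℓ)

Var : Set
Var = ℕ

-- A literal (v , b): b = true means v, b = false means ¬v.
Literal : Set
Literal = Var × Bool

Clause : Set
Clause = List Literal

CNF : Set
CNF = List Clause

VarSet : Set₁
VarSet = Pred Var 0ℓ

TotalAssignment : Set
TotalAssignment = Var → Bool

Assignment : Set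
Assignment = Var → Maybe Bool

_⊆ₐ_ : Assignment → Assignment → Set
q ⊆ₐ q' = ∀ (v : Var) (b : Bool) → q v ≡ just b → q' v ≡ just b

filterB : {A : Set} → (A → Bool) → List A → List A
filterB p [] = []
filterB p (x ∷ xs) = if p x then x ∷ filterB p xs else filterB p xs

anyB : {A : Set} → (A → Bool) → List A → Bool
anyB p [] = false
anyB p (x ∷ xs) = p x ∨ anyB p xs

allB : {A : Set} → (A → Bool) → List A → Bool
allB p [] = true
allB p (x ∷ xs) = p x ∧ allB p xs

litSat : TotalAssignment → Literal → Set
litSat a (v , b) = a v ≡ b

clauseSat : TotalAssignment → Clause → Set
clauseSat a C = Any (litSat a) C

Sat : TotalAssignment → CNF → Set
Sat a F = All (clauseSat a) F

-- ∃X[F] evaluated at the point y (only values of y on variables outside X matter).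
ExistsSat : VarSet → CNF → TotalAssignment → Set
ExistsSat X F y = Σ TotalAssignment λ a → (∀ v → ¬ X v → a v ≡ y v) × Sat a F

ExEquiv : VarSet → CNF → CNF → Set
ExEquiv X F G = ∀ y → (ExistsSat X F y → ExistsSat X G y) × (ExistsSat X G y → ExistsSat X F y)

eqMB : Maybe Bool → Bool → Bool
eqMB (just true)  true  = true
eqMB (just false) false = true
eqMB _            _     = false

litTrueB : Assignment → Literal → Bool
litTrueB q (v , b) = eqMB (q v) b

litFalseB : Assignment → Literal → Bool
litFalseB q (v , b) = eqMB (q v) (not b)

-- C_q : nothing stands for the constant 1 (C satisfied by q);
-- otherwise C minus its falsified literals.
restrictClause : Assignment → Clause → Maybe Clause
restrictClause q C =
  if anyB (litTrueB q) C then nothing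
  else just (filterB (λ l → not (litFalseB q l)) C)

restrictCNF : Assignment → CNF → CNF
restrictCNF q [] = []
restrictCNF q (C ∷ F) with restrictClause q C
... | nothing = restrictCNF q F
... | just C' = C' ∷ restrictCNF q F

eqLitB : Literal → Literal → Bool
eqLitB (v , b) (w , c) = (v ≡ᵇ w) ∧ does (Data.Bool._≟_ b c)

memB : Literal → Clause → Bool
memB l C = anyB (eqLitB l) C

subB : Clause → Clause → Bool
subB C D = allB (λ l → memB l D) C

-- clauses are sets of literals: compare as sets
clauseEqB : Clause → Clause → Bool
clauseEqB C D = subB C D ∧ subB D C

removeClause : Clause → CNF → CNF
removeClause C F = filterB (λ D → not (clauseEqB C D)) F

removeMaybe : Maybe Clause → CNF → CNF
removeMaybe nothing  F = F
removeMaybe (just C) F = removeClause C F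

Redundant : VarSet → CNF → Maybe Clause → Set
Redundant X F C = ExEquiv X F (removeMaybe C F)

record DSequent : Set where
  constructor dseq
  field
    cond   : Assignment
    U      : List Clause
    clause : Clause

Holds : VarSet → CNF → DSequent → Set
Holds X F (dseq q U C) = Redundant X (restrictCNF q F) (restrictClause q C)

ScaleDown : VarSet → CNF → DSequent → Set
ScaleDown X F (dseq q U C) = ∀ (q' : Assignment) → q ⊆ₐ q' → Holds X F (dseq q' U C)

Resolvable : Assignment → Assignment → Var → Set
Resolvable r s v =
  (Σ Bool λ b → (r v ≡ just b) × (s v ≡ just (not b))) ×
  (∀ (w : Var) (b : Bool) → r w ≡ just b → s w ≡ just (not b) → w ≡ v)

unionA : Maybe Bool → Maybe Bool → Maybe Bool
unionA (just b) _ = just b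
unionA nothing  m = m

resolventCond : Assignment → Assignment → Var → Assignment
resolventCond r s v w = if v ≡ᵇ w then nothing else unionA (r w) (s w)

resolvent : DSequent → DSequent → Var → DSequent
resolvent (dseq r U₁ C) (dseq s U₂ _) v = dseq (resolventCond r s v) (U₁ ++ U₂) C

{-# OPTIONS --safe #-}

-- Let q extend the resolvent conditional (r ∪ s minus v).  If q assigns v, then q extends r or s,
-- because v is the only variable on which r and s clash, and the scale-down property of that
-- D-sequent applies.  If q leaves v free, both extensions q[v ≔ b] are of the first kind, and
-- redundancy in the two branches gives redundancy under q: a model a of F_q ∖ {C_q} is a model of
-- the branch b = a(v) without C_{q[v ≔ b]}, redundancy there yields a model of the whole branch,
-- and resetting v to b in it gives a model of F_q that agrees with a outside X.
module Submission where

open import Defs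
open import Data.Bool using (Bool; true; false; not; T; _∨_; _∧_; if_then_else_) renaming (_≟_ to _≟ᵇ_)
open import Data.Bool.ListAction using (any; all)
open import Data.Bool.Properties using (T-∧; ¬-not; not-¬)
open import Data.Empty using (⊥-elim)
open import Data.List using (List; []; _∷_; _++_; filterᵇ)
open import Data.List.Membership.Propositional using (_∈_; find; lose)
open import Data.List.Membership.Propositional.Properties using (∈-filter⁺; ∈-filter⁻)
open import Data.List.Relation.Binary.Subset.Propositional using (_⊆_)
open import Data.List.Relation.Binary.Subset.Propositional.Properties using (Any-resp-⊆)
open import Data.List.Relation.Unary.All as All using (All)
open import Data.List.Relation.Unary.All.Properties using (all⁺; all⁻)
open import Data.List.Relation.Unary.Any as Any using (Any; here; there)
open import Data.List.Relation.Unary.Any.Properties using (any⇔)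
open import Data.Maybe using (Maybe; just; nothing)
open import Data.Maybe.Properties using (just-injective)
open import Data.Maybe.Relation.Binary.Pointwise as Pointwise using (Pointwise; just; nothing; drop-just)
open import Data.Nat using (_≟_)
open import Data.Nat.Properties using (≡ᵇ⇒≡; ≡⇒≡ᵇ)
open import Data.Product as Product using (∃-syntax; _×_; _,_; proj₁; proj₂)
open import Data.Sum using (_⊎_; inj₁; inj₂; [_,_])
open import Data.Unit using (tt)
open import Function using (_∘_; id; _⇔_; mk⇔; Equivalence)
open import Relation.Binary.PropositionalEquality using (_≡_; _≢_; refl; sym; trans; cong; subst)
open import Relation.Nullary using (¬_; Dec; yes; no; contradiction)
open import Relation.Nullary.Decidable using (does; dec-true; dec-false; map′; T?)

open Equivalence using (to; from)

T-not : ∀ {x} → T (not x) ⇔ (¬ T x)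
T-not {true}  = mk⇔ (λ ()) (λ ¬t → ¬t tt)
T-not {false} = mk⇔ (λ _ ()) (λ _ → tt)

module _ {A : Set} (p : A → Bool) where

  filterB≡filterᵇ : ∀ xs → filterB p xs ≡ filterᵇ p xs
  filterB≡filterᵇ []       = refl
  filterB≡filterᵇ (x ∷ xs) with p x
  ... | true  = cong (x ∷_) (filterB≡filterᵇ xs)
  ... | false = filterB≡filterᵇ xs

  anyB≡any : ∀ xs → anyB p xs ≡ any p xs
  anyB≡any []       = refl
  anyB≡any (x ∷ xs) = cong (p x ∨_) (anyB≡any xs)

  allB≡all : ∀ xs → allB p xs ≡ all p xs
  allB≡all []       = refl
  allB≡all (x ∷ xs) = cong (p x ∧_) (allB≡all xs)

  ∈-filterB⁺ : ∀ {x xs} → x ∈ xs → T (p x) → x ∈ filterB p xs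
  ∈-filterB⁺ {xs = xs} rewrite filterB≡filterᵇ xs = ∈-filter⁺ (T? ∘ p)

  ∈-filterB⁻ : ∀ {x} xs → x ∈ filterB p xs → x ∈ xs × T (p x)
  ∈-filterB⁻ xs rewrite filterB≡filterᵇ xs = ∈-filter⁻ (T? ∘ p)

  T-anyB : ∀ {xs} → T (anyB p xs) ⇔ Any (T ∘ p) xs
  T-anyB {xs} rewrite anyB≡any xs = mk⇔ (from any⇔) (to any⇔)

  T-allB : ∀ {xs} → T (allB p xs) ⇔ All (T ∘ p) xs
  T-allB {xs} rewrite allB≡all xs = mk⇔ (all⁺ p xs) (all⁻ p)

eqLitB⇒≡ : ∀ l m → T (eqLitB l m) → l ≡ m
eqLitB⇒≡ (v , b) (w , c) with b ≟ᵇ c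
... | yes refl = λ t → cong (_, b) (≡ᵇ⇒≡ v w (proj₁ (to T-∧ t)))
... | no _     = λ t → ⊥-elim (proj₂ (to T-∧ t))

eqLitB-refl : ∀ l → T (eqLitB l l)
eqLitB-refl (v , b) rewrite dec-true (b ≟ᵇ b) refl = from T-∧ (≡⇒≡ᵇ v v refl , tt)

T-memB : ∀ {l C} → T (memB l C) ⇔ l ∈ C
T-memB {l} = mk⇔ (Any.map (eqLitB⇒≡ l _) ∘ to (T-anyB (eqLitB l)))
                 (from (T-anyB (eqLitB l)) ∘ Any.map λ { refl → eqLitB-refl l })

T-subB : ∀ {C D} → T (subB C D) ⇔ C ⊆ D
T-subB {C} {D} = mk⇔
  (λ t {l} l∈C → to T-memB (All.lookup (to (T-allB memB-D) t) l∈C))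
  (λ (C⊆D : C ⊆ D) → from (T-allB memB-D) (All.tabulate λ l∈C → from T-memB (C⊆D l∈C)))
  where
  memB-D : Literal → Bool
  memB-D l = memB l D

infix 4 _≋_
_≋_ : Clause → Clause → Set
C ≋ D = C ⊆ D × D ⊆ C

≋-sym : ∀ {C D} → C ≋ D → D ≋ C
≋-sym (C⊆D , D⊆C) = D⊆C , C⊆D

≋-trans : ∀ {C D E} → C ≋ D → D ≋ E → C ≋ E
≋-trans (C⊆D , D⊆C) (D⊆E , E⊆D) =
  (λ l∈C → D⊆E (C⊆D l∈C)) , (λ l∈E → D⊆C (E⊆D l∈E))

infix 4 _≋ₘ_
_≋ₘ_ : Maybe Clause → Maybe Clause → Set
_≋ₘ_ = Pointwise _≋_

≋ₘ-sym : ∀ {m m′} → m ≋ₘ m′ → m′ ≋ₘ m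
≋ₘ-sym = Pointwise.sym ≋-sym

≋ₘ-trans : ∀ {m m′ m″} → m ≋ₘ m′ → m′ ≋ₘ m″ → m ≋ₘ m″
≋ₘ-trans = Pointwise.trans ≋-trans

T-clauseEqB : ∀ {C D} → T (clauseEqB C D) ⇔ C ≋ D
T-clauseEqB {C} {D} = mk⇔ (Product.map (to T-subB) (to T-subB) ∘ to T-∧)
                          (from T-∧ ∘ Product.map (from (T-subB {C} {D})) (from T-subB))

_≋?_ : ∀ C D → Dec (C ≋ D)
C ≋? D = map′ (to T-clauseEqB) (from T-clauseEqB) (T? (clauseEqB C D))

infix 4 _⊨_
_⊨_ : Assignment → Literal → Set
q ⊨ l = q (proj₁ l) ≡ just (proj₂ l)

negate : Literal → Literal
negate l = proj₁ l , not (proj₂ l)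

⊨-mono : ∀ {q q′ l} → q ⊆ₐ q′ → q ⊨ l → q′ ⊨ l
⊨-mono {l = v , b} q⊆q′ = q⊆q′ v b

⊨-consistent : ∀ {q} l → q ⊨ l → ¬ q ⊨ negate l
⊨-consistent (v , b) q⊨l q⊨¬l = not-¬ refl (just-injective (trans (sym q⊨l) q⊨¬l))

T-eqMB : ∀ {m b} → T (eqMB m b) ⇔ m ≡ just b
T-eqMB {just true}  {true}  = mk⇔ (λ _ → refl) (λ _ → tt)
T-eqMB {just false} {false} = mk⇔ (λ _ → refl) (λ _ → tt)
T-eqMB {just true}  {false} = mk⇔ (λ ()) (λ ())
T-eqMB {just false} {true}  = mk⇔ (λ ()) (λ ())
T-eqMB {nothing}    {_}     = mk⇔ (λ ()) (λ ())

T-litTrueB : ∀ {q} l → T (litTrueB q l) ⇔ q ⊨ l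
T-litTrueB (v , b) = T-eqMB

T-litFalseB : ∀ {q} l → T (litFalseB q l) ⇔ q ⊨ negate l
T-litFalseB (v , b) = T-eqMB

dropFalsified : Assignment → Clause → Clause
dropFalsified q C = filterB (λ l → not (litFalseB q l)) C

∈-dropFalsified⁺ : ∀ q {l C} → l ∈ C → ¬ q ⊨ negate l → l ∈ dropFalsified q C
∈-dropFalsified⁺ q {l} l∈C ¬q⊨¬l =
  ∈-filterB⁺ _ l∈C (from T-not (¬q⊨¬l ∘ to (T-litFalseB {q} l)))

∈-dropFalsified⁻ : ∀ {q l} C → l ∈ dropFalsified q C → l ∈ C × ¬ q ⊨ negate l
∈-dropFalsified⁻ {q} {l} C l∈C′ =
  let l∈C , t = ∈-filterB⁻ _ C l∈C′ in l∈C , to T-not t ∘ from (T-litFalseB {q} l)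

dropFalsified-⊆ : ∀ {q} C → dropFalsified q C ⊆ C
dropFalsified-⊆ C = proj₁ ∘ ∈-dropFalsified⁻ C

dropFalsified-mono : ∀ {q C D} → C ⊆ D → dropFalsified q C ⊆ dropFalsified q D
dropFalsified-mono {C = C} C⊆D l∈C′ =
  let l∈C , ¬q⊨¬l = ∈-dropFalsified⁻ C l∈C′
  in ∈-dropFalsified⁺ _ (C⊆D l∈C) ¬q⊨¬l

dropFalsified-resp-≋ : ∀ {q C D} → C ≋ D → dropFalsified q C ≋ dropFalsified q D
dropFalsified-resp-≋ (C⊆D , D⊆C) = dropFalsified-mono C⊆D , dropFalsified-mono D⊆C

dropFalsified-antimono : ∀ {q q′} C → q ⊆ₐ q′ → dropFalsified q′ C ⊆ dropFalsified q C
dropFalsified-antimono C q⊆q′ l∈C′ =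
  let l∈C , ¬q′⊨¬l = ∈-dropFalsified⁻ C l∈C′
  in ∈-dropFalsified⁺ _ l∈C (¬q′⊨¬l ∘ ⊨-mono q⊆q′)

dropFalsified-unassigned : ∀ {q l} C → ¬ Any (q ⊨_) C → l ∈ dropFalsified q C →
  q (proj₁ l) ≡ nothing
dropFalsified-unassigned {q} {w , c} C ¬sat l∈C′ with q w in e
... | nothing = refl
... | just c′ with c′ ≟ᵇ c | ∈-dropFalsified⁻ C l∈C′
...   | yes refl | l∈C , _      = contradiction (lose l∈C e) ¬sat
...   | no c′≢c  | _ , ¬q⊨¬l   = contradiction (trans e (cong just (¬-not c′≢c))) ¬q⊨¬l

data Restriction (q : Assignment) (C : Clause) : Maybe Clause → Set where
  satisfied : Any (q ⊨_) C → Restriction q C nothing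
  reduced   : ¬ Any (q ⊨_) C → Restriction q C (just (dropFalsified q C))

restriction : ∀ q C → Restriction q C (restrictClause q C)
restriction q C with anyB (litTrueB q) C in e
... | true  = satisfied (Any.map (λ {l} → to (T-litTrueB {q} l)) (to (T-anyB _) (subst T (sym e) tt)))
... | false = reduced λ sat →
  subst T e (from (T-anyB _) (Any.map (λ {l} → from (T-litTrueB {q} l)) sat))

restriction-just : ∀ {q D D′} → restrictClause q D ≡ just D′ → Restriction q D (just D′)
restriction-just {q} {D} e = subst (Restriction q D) e (restriction q D)

restrictClause-unsat : ∀ {q C} → ¬ Any (q ⊨_) C →
  restrictClause q C ≡ just (dropFalsified q C)
restrictClause-unsat {q} {C} ¬sat with restrictClause q C | restriction q C
... | _ | satisfied sat = contradiction sat ¬sat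
... | _ | reduced _     = refl

∈-restrictCNF⁻ : ∀ {q D′} F → D′ ∈ restrictCNF q F →
  ∃[ D ] D ∈ F × restrictClause q D ≡ just D′
∈-restrictCNF⁻ {q} (D ∷ F) D′∈F′ with restrictClause q D in e | D′∈F′
... | nothing | D′∈F″       = Product.map₂ (Product.map₁ there) (∈-restrictCNF⁻ F D′∈F″)
... | just _  | here refl   = D , here refl , e
... | just _  | there D′∈F″ = Product.map₂ (Product.map₁ there) (∈-restrictCNF⁻ F D′∈F″)

∈-restrictCNF⁺ : ∀ {q D D′ F} → D ∈ F → restrictClause q D ≡ just D′ → D′ ∈ restrictCNF q F
∈-restrictCNF⁺ (here refl) e rewrite e = here refl
∈-restrictCNF⁺ {q} {F = D ∷ _} (there D∈F) e with restrictClause q D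
... | nothing = ∈-restrictCNF⁺ D∈F e
... | just _  = there (∈-restrictCNF⁺ D∈F e)

restrictClause-resp-≋ : ∀ {q C D} → C ≋ D → restrictClause q C ≋ₘ restrictClause q D
restrictClause-resp-≋ {q} {C} {D} C≋D@(C⊆D , D⊆C)
  with restrictClause q C | restriction q C | restrictClause q D | restriction q D
... | _ | satisfied _    | _ | satisfied _    = nothing
... | _ | reduced _      | _ | reduced _      = just (dropFalsified-resp-≋ C≋D)
... | _ | satisfied satC | _ | reduced ¬satD  = contradiction (Any-resp-⊆ C⊆D satC) ¬satD
... | _ | reduced ¬satC  | _ | satisfied satD = contradiction (Any-resp-⊆ D⊆C satD) ¬satC

restrictClause-dropFalsified : ∀ {q q′} C → q ⊆ₐ q′ →
  restrictClause q′ (dropFalsified q C) ≋ₘ restrictClause q′ C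
restrictClause-dropFalsified {q} {q′} C q⊆q′
  with restrictClause q′ (dropFalsified q C) | restriction q′ (dropFalsified q C)
     | restrictClause q′ C                   | restriction q′ C
... | _ | satisfied _     | _ | satisfied _   = nothing
... | _ | reduced _       | _ | reduced _     =
  just (dropFalsified-mono {q′} (dropFalsified-⊆ {q} C) , twice⊇)
  where
  twice⊇ : dropFalsified q′ C ⊆ dropFalsified q′ (dropFalsified q C)
  twice⊇ l∈C′ = let l∈C , ¬q′⊨¬l = ∈-dropFalsified⁻ C l∈C′ in
    ∈-dropFalsified⁺ q′ (∈-dropFalsified⁺ q l∈C (¬q′⊨¬l ∘ ⊨-mono q⊆q′)) ¬q′⊨¬l
... | _ | satisfied satC′ | _ | reduced ¬satC  =
  contradiction (Any-resp-⊆ (dropFalsified-⊆ {q} C) satC′) ¬satC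
... | _ | reduced ¬satC′  | _ | satisfied satC =
  contradiction satC′ ¬satC′
  where
  satC′ : Any (q′ ⊨_) (dropFalsified q C)
  satC′ = let l , l∈C , q′⊨l = find satC in
    lose (∈-dropFalsified⁺ q l∈C (⊨-consistent {q′} l q′⊨l ∘ ⊨-mono {q} {q′} q⊆q′)) q′⊨l

∈-removeClause⁺ : ∀ {C D} F → D ∈ F → ¬ C ≋ D → D ∈ removeClause C F
∈-removeClause⁺ F D∈F C≉D = ∈-filterB⁺ _ D∈F (from T-not (C≉D ∘ to T-clauseEqB))

Sat-removeClause⁻ : ∀ {a C D} F → Sat a (removeClause C F) → D ∈ F → ¬ C ≋ D →
  clauseSat a D
Sat-removeClause⁻ F sat D∈F C≉D = All.lookup sat (∈-removeClause⁺ F D∈F C≉D)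

Sat-removeMaybe : ∀ {a} m F → Sat a F → Sat a (removeMaybe m F)
Sat-removeMaybe nothing  F sat = sat
Sat-removeMaybe (just C) F sat =
  All.tabulate λ D∈ → All.lookup sat (proj₁ (∈-filterB⁻ _ F D∈))

Sat-removeMaybe⁺ : ∀ {a} m F → (∀ {D} → D ∈ F → ¬ m ≋ₘ just D → clauseSat a D) →
  Sat a (removeMaybe m F)
Sat-removeMaybe⁺ nothing  F sat = All.tabulate λ D∈F → sat D∈F λ ()
Sat-removeMaybe⁺ (just C) F sat = All.tabulate λ D∈ →
  let D∈F , t = ∈-filterB⁻ _ F D∈ in sat D∈F (to T-not t ∘ from T-clauseEqB ∘ drop-just)

Redundant-intro : ∀ {X G} m → (∀ y → ExistsSat X (removeMaybe m G) y → ExistsSat X G y) →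
  Redundant X G m
Redundant-intro {G = G} m back y =
  (λ (a , a≈y , sat) → a , a≈y , Sat-removeMaybe m G sat) , back y

infixl 6 _[_]≔_
_[_]≔_ : {A : Set} → (Var → A) → Var → A → Var → A
(f [ v ]≔ x) w = if does (w ≟ v) then x else f w

update-same : ∀ {A : Set} (f : Var → A) v x → (f [ v ]≔ x) v ≡ x
update-same f v x rewrite dec-true (v ≟ v) refl = refl

update-other : ∀ {A : Set} (f : Var → A) {v w} x → w ≢ v → (f [ v ]≔ x) w ≡ f w
update-other f {v} {w} x w≢v rewrite dec-false (w ≟ v) w≢v = refl

⊆ₐ-update : ∀ {q v} b → q v ≡ nothing → q ⊆ₐ (q [ v ]≔ just b)
⊆ₐ-update {q} {v} b qv w c qw with w ≟ v
... | yes refl = contradiction (trans (sym qv) qw) λ ()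
... | no w≢v   = trans (update-other q (just b) w≢v) qw

⊆ₐ-trans : ∀ {q₁ q₂ q₃} → q₁ ⊆ₐ q₂ → q₂ ⊆ₐ q₃ → q₁ ⊆ₐ q₃
⊆ₐ-trans q₁⊆q₂ q₂⊆q₃ v b = q₂⊆q₃ v b ∘ q₁⊆q₂ v b

⊨-update⁻ : ∀ {q v b} l → (q [ v ]≔ just b) ⊨ l → ¬ q ⊨ l → l ≡ (v , b)
⊨-update⁻ {q} {v} {b} (w , c) qb⊨l ¬q⊨l with w ≟ v
... | yes refl = cong (v ,_) (just-injective (trans (sym qb⊨l) (update-same q v (just b))))
... | no w≢v   = contradiction (trans (sym (update-other q (just b) w≢v)) qb⊨l) ¬q⊨l

clauseSat-dropFalsified-refine : ∀ {q a v} D → ¬ Any ((q [ v ]≔ just (a v)) ⊨_) D →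
  clauseSat a (dropFalsified q D) → clauseSat a (dropFalsified (q [ v ]≔ just (a v)) D)
clauseSat-dropFalsified-refine {q} {a} {v} D ¬sat satD with find satD
... | (w , c) , l∈D′ , a⊨l with ∈-dropFalsified⁻ D l∈D′ | w ≟ v
...   | l∈D , _      | yes refl =
  contradiction (lose l∈D (trans (update-same q v _) (cong just a⊨l))) ¬sat
...   | l∈D , ¬q⊨¬l | no w≢v   =
  lose (∈-dropFalsified⁺ _ l∈D (¬q⊨¬l ∘ trans (sym (update-other q _ w≢v)))) a⊨l

clauseSat-update-reduced : ∀ {q a v b} D → ¬ Any ((q [ v ]≔ just b) ⊨_) D →
  clauseSat a (dropFalsified (q [ v ]≔ just b) D) →
  clauseSat (a [ v ]≔ b) (dropFalsified (q [ v ]≔ just b) D)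
clauseSat-update-reduced {q} {a} {v} {b} D ¬sat satD with find satD
... | (w , c) , l∈D′ , a⊨l with w ≟ v
...   | yes refl =
  contradiction (trans (sym (update-same q v (just b))) (dropFalsified-unassigned D ¬sat l∈D′)) λ ()
...   | no w≢v   = lose l∈D′ (trans (update-other a b w≢v) a⊨l)

Sat-restrictCNF-update : ∀ {q a v b} F → q v ≡ nothing →
  Sat a (restrictCNF (q [ v ]≔ just b) F) → Sat (a [ v ]≔ b) (restrictCNF q F)
Sat-restrictCNF-update {q} {a} {v} {b} F qv sat = All.tabulate λ D′∈ →
  let D , D∈F , e = ∈-restrictCNF⁻ F D′∈ in reducedSat D∈F (restriction-just e)
  where
  qb : Assignment
  qb = q [ v ]≔ just b

  reducedSat : ∀ {D D′} → D ∈ F → Restriction q D (just D′) → clauseSat (a [ v ]≔ b) D′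
  reducedSat {D} D∈F (reduced ¬satq) with restrictClause qb D | restriction qb D
  ... | _ | satisfied satqb =
    let l , l∈D , qb⊨l = find satqb
        l≡v,b = ⊨-update⁻ {q} l qb⊨l (¬satq ∘ lose l∈D)
        v,b∈D = subst (_∈ D) l≡v,b l∈D
        ¬q⊨¬v,b = λ q⊨¬v,b → contradiction (trans (sym qv) q⊨¬v,b) λ ()
    in lose (∈-dropFalsified⁺ q v,b∈D ¬q⊨¬v,b) (update-same a v b)
  ... | _ | reduced ¬satqb =
    Any-resp-⊆ (dropFalsified-antimono D (⊆ₐ-update b qv))
      (clauseSat-update-reduced D ¬satqb
        (All.lookup sat (∈-restrictCNF⁺ D∈F (restrictClause-unsat ¬satqb))))

-- If D_q ≋ C_q then D_q′ ≋ C_q′ for q′ = q[v ≔ a v], since restricting twice is restricting once;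
-- so every clause left in the branch after removing C_q′ refines one left after removing C_q.
Sat-removeMaybe-restrictCNF-update : ∀ {q a v C} F → q v ≡ nothing →
  Sat a (removeClause (dropFalsified q C) (restrictCNF q F)) →
  Sat a (removeMaybe (restrictClause (q [ v ]≔ just (a v)) C)
                     (restrictCNF (q [ v ]≔ just (a v)) F))
Sat-removeMaybe-restrictCNF-update {q} {a} {v} {C} F qv sat =
  Sat-removeMaybe⁺ _ _ λ D″∈ C≉D″ →
  let D , D∈F , e = ∈-restrictCNF⁻ F D″∈ in kept D∈F e C≉D″
  where
  qa : Assignment
  qa = q [ v ]≔ just (a v)

  q⊆qa : q ⊆ₐ qa
  q⊆qa = ⊆ₐ-update (a v) qv

  kept : ∀ {D D″} → D ∈ F → restrictClause qa D ≡ just D″ → ¬ restrictClause qa C ≋ₘ just D″ →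
    clauseSat a D″
  kept {D} D∈F e C≉D″ with restriction-just {qa} {D} e
  ... | reduced ¬satqa with dropFalsified q C ≋? dropFalsified q D
  ...   | no C′≉D′ =
    clauseSat-dropFalsified-refine D ¬satqa
      (Sat-removeClause⁻ _ sat (∈-restrictCNF⁺ D∈F (restrictClause-unsat ¬satq)) C′≉D′)
    where
    ¬satq : ¬ Any (q ⊨_) D
    ¬satq = ¬satqa ∘ Any.map (⊨-mono q⊆qa)
  ...   | yes C′≋D′ = contradiction (subst (restrictClause qa C ≋ₘ_) e C≈D) C≉D″
    where
    C≈D : restrictClause qa C ≋ₘ restrictClause qa D
    C≈D = ≋ₘ-trans (≋ₘ-sym (restrictClause-dropFalsified C q⊆qa))
            (≋ₘ-trans (restrictClause-resp-≋ C′≋D′) (restrictClause-dropFalsified D q⊆qa))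

Holds-split : ∀ {X F C U q v} → q v ≡ nothing →
  (∀ b → Holds X F (dseq (q [ v ]≔ just b) U C)) → Holds X F (dseq q U C)
Holds-split {X} {F} {C} {U} {q} {v} qv holds with restrictClause q C | restriction q C
... | _ | satisfied _ = λ y → id , id
... | _ | reduced _   = Redundant-intro (just (dropFalsified q C)) λ y (a , a≈y , sat) →
  let a′ , a′≈y , sat′ =
        proj₂ (holds (a v) y)
          (a , a≈y , Sat-removeMaybe-restrictCNF-update {q} {a} {v} {C} F qv sat)
  in a′ [ v ]≔ a v , agree {a} {a′} {y} a≈y a′≈y , Sat-restrictCNF-update {q} {a′} F qv sat′
  where
  agree : ∀ {a a′ y} → (∀ w → ¬ X w → a w ≡ y w) → (∀ w → ¬ X w → a′ w ≡ y w) →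
    ∀ w → ¬ X w → (a′ [ v ]≔ a v) w ≡ y w
  agree {a} {a′} a≈y a′≈y w w∉X with w ≟ v
  ... | yes refl = trans (update-same a′ v (a v)) (a≈y v w∉X)
  ... | no w≢v   = trans (update-other a′ (a v) w≢v) (a′≈y w w∉X)

⊆ₐ-except : ∀ {t q v} → t v ≡ q v → (∀ w c → w ≢ v → t w ≡ just c → q w ≡ just c) →
  t ⊆ₐ q
⊆ₐ-except {v = v} tv≡qv off w c tw with w ≟ v
... | yes refl = trans (sym tv≡qv) tw
... | no w≢v   = off w c w≢v tw

resolventCond-⊇ˡ : ∀ {r s v w c} → w ≢ v → r w ≡ just c → resolventCond r s v w ≡ just c
resolventCond-⊇ˡ {r} {s} {v} {w} w≢v rw rewrite dec-false (v ≟ w) (w≢v ∘ sym) | rw = refl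

resolventCond-⊇ʳ : ∀ {r s v w c} → Resolvable r s v → w ≢ v → s w ≡ just c →
  resolventCond r s v w ≡ just c
resolventCond-⊇ʳ {r} {s} {v} {w} {c} (_ , unique) w≢v sw
  rewrite dec-false (v ≟ w) (w≢v ∘ sym) with r w in rw
... | nothing = sw
... | just c′ with c′ ≟ᵇ c
...   | yes refl = refl
...   | no c′≢c  =
  contradiction (unique w c′ rw (trans sw (cong just (¬-not (c′≢c ∘ sym))))) w≢v

resolventCond-cover : ∀ {r s v q b} → Resolvable r s v → resolventCond r s v ⊆ₐ q →
  q v ≡ just b → r ⊆ₐ q ⊎ s ⊆ₐ q
resolventCond-cover {r} {s} {v} {q} {b} res@((b₀ , rv , sv) , _) res⊆q qv with b ≟ᵇ b₀
... | yes refl = inj₁ (⊆ₐ-except {r} {q} (trans rv (sym qv)) λ w c w≢v →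
                   res⊆q w c ∘ resolventCond-⊇ˡ {r} {s} w≢v)
... | no b≢b₀  = inj₂ (⊆ₐ-except {s} {q} sv≡qv λ w c w≢v →
                   res⊆q w c ∘ resolventCond-⊇ʳ {r} {s} res w≢v)
  where
  sv≡qv : s v ≡ q v
  sv≡qv = trans sv (sym (trans qv (cong just (¬-not b≢b₀))))

lemma5 : (X : VarSet) (F : CNF) (C : Clause) → C ∈ F →
    (r s : Assignment) (U₁ U₂ : List Clause) (v : Var) →
    Holds X F (dseq r U₁ C) → Holds X F (dseq s U₂ C) →
    Resolvable r s v →
    ScaleDown X F (dseq r U₁ C) → ScaleDown X F (dseq s U₂ C) →
    ScaleDown X F (resolvent (dseq r U₁ C) (dseq s U₂ C) v)
lemma5 X F C _ r s U₁ U₂ v _ _ res scaleᵣ scaleₛ = scaleDown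
  where
  holdsAt : ∀ q {b} → resolventCond r s v ⊆ₐ q → q v ≡ just b →
    Holds X F (dseq q (U₁ ++ U₂) C)
  holdsAt q res⊆q qv = [ scaleᵣ q , scaleₛ q ] (resolventCond-cover res res⊆q qv)

  scaleDown : ScaleDown X F (dseq (resolventCond r s v) (U₁ ++ U₂) C)
  scaleDown q res⊆q with q v in qv
  ... | just _  = holdsAt q res⊆q qv
  ... | nothing = Holds-split {X} {F} {C} {U₁ ++ U₂} qv λ b →
    holdsAt (q [ v ]≔ just b) (⊆ₐ-trans res⊆q (⊆ₐ-update b qv)) (update-same q v (just b))
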